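{- Let $P=\langle L,\ell^o,\ell^e,V,\tau\rangle$ be a program and let $\tilde P=\langle L,\ell^o,\ell^e,V\cup C\cup B,\tau\wedge\tau_B\rangle$ be its bounded version (defined in the context). Then $P$ is safe iff $\tilde P$ is safe. More precisely: if $\tilde{\mathscr{C}}=\langle\bar\ell,\bar s\rangle$ is a counterexample to $\tilde P$, then projecting each state of $\bar s$ onto $V$ gives a counterexample $\langle\bar\ell,\bar s|_V\rangle$ to $P$; and if $\tilde\pi$ is a safety proof of $\tilde P$, then $\pi=\lambda\ell.\ \{\forall B\ge 0, C\ge 0.\ \varphi \mid \varphi\in\tilde\pi(\ell)\}$ (universally quantifying all variables of $B\cup C$, restricted to non-negative values) is a safety proof for $P$.
   Context: A program is a tuple $P=\langle L,\ell^o,\ell^e,V,\tau\rangle$: $L$ a finite set of control locations, $\ell^o,\ell^e\in L$ the initial and error locations, $V$ a set of Boolean or rational variables, and $\tau:L\times L\to$ formulas over $V\cup V'$ in propositional linear rational arithmetic ($V'$ primed next-state copies; $X'$ denotes $X$ with all variables primed), with $\tau(\ell,\ell^o)=\bot$, $\tau(\ell^e,\ell)=\bot$. A control path is a sequence $\ell^o=\ell_0,\dots,\ell_k$ with $\tau(\ell_i,\ell_{i+1})\ne\bot$; it is feasible if there are states $s_0,\dots,s_k$ (valuations of the variables) with $\tau(\ell_i,\ell_{i+1})[V\leftarrow s_i,V'\leftarrow s_{i+1}]=\top$. A counterexample is a pair $\langle\bar\ell,\bar s\rangle$ of a feasible control path ending at $\ell^e$ with a witnessing state sequence; the program is safe iff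 no feasible control path ends at $\ell^e$. A safety proof is $\pi:L\to$ sets of formulas over the variables with $\bigwedge\pi(\ell^e)\Rightarrow\bot$, $\top\Rightarrow\bigwedge\pi(\ell^o)$, and $(\bigwedge\pi(\ell_i)\wedge\tau(\ell_i,\ell_j))\Rightarrow\bigwedge\pi(\ell_j)'$ for all $\ell_i,\ell_j$. Bounded version: fix a weak topological order (WTO) of $L$, i.e. a total order $<$ on $L$ together with a well-parenthesized bracketing without two consecutive open brackets; the locations within a matching bracket pair form a component, the $<$-smallest location of a component is its head, and $\mathrm{hds}(\ell)$ is the outside-in list of heads of the components containing $\ell$; it is required that whenever $\tau(\ell_i,\ell_j)\neq\bot$ and $\ell_j\le\ell_i$ then $\ell_j\in\mathrm{hds}(\ell_i)$; $\ell^o$ is smallest and $\ell^e$ largest. For each head $h$ introduce fresh rational variables $c_h$ (counter) and $b_h$ (bound); $C=\{c_h\}$, $B=\{b_h\}$. For $\ell_i,\ell_j\in L$, $\tau_B(\ell_i,\ell_j)$ is the conjunction of: (Entry) if $\ell_i<\ell_j$ and $\ell_j$ is a head, no constraint on $c_{\ell_j}'$ (nondeterministic assignment); (Re-entry) if $\ell_j\le\ell_i$, the constraint $0\le c_{\ell_j}'\wedge c_{\ell_j}'=c_{\ell_j}-1\wedge c_{\ell_j}\le b_{\ell_j}$; (Exit) if $\ell_i<\ell_j$ and $\mathrm{hds}(\ell_i)\supset\mathrm{hds}(\ell_j)$, the constraint $c_h=0$ for each $h\in\mathrm{hds}(\ell_i)\setminus\mathrm{hds}(\ell_j)$; (Pass-on)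 the constraint $c_h'=c_h$ for each $h\in\mathrm{hds}(\ell_j)\setminus\{\ell_j\}$. -}

module Defs where

open import Data.Nat using (ℕ; suc)
open import Data.Fin using (Fin; zero; suc; inject₁; fromℕ) renaming (_≟_ to _≟ᶠ_)
open import Data.Bool using (Bool; true; false; T)
open import Data.Rational using (ℚ; 0ℚ; 1ℚ; _-_; _≤_)
open import Data.List using (List; []; _∷_; _++_; [_])
open import Data.Bool.ListAction using (any)
open import Data.List.Membership.Propositional using (_∈_; _∉_)
open import Data.List.Relation.Unary.Unique.Propositional using (Unique)
open import Data.Maybe using (Maybe; just; nothing; _<∣>_) renaming (map to mmap; fromMaybe to mfromMaybe)
open import Data.Product using (Σ; _×_; _,_; proj₁; ∃-syntax)
open import Data.Sum using (_⊎_; inj₁; inj₂)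
open import Data.Unit using (⊤)
open import Data.Empty using (⊥)
open import Relation.Nullary using (¬_)
open import Relation.Nullary.Decidable using (⌊_⌋)
open import Relation.Binary.PropositionalEquality using (_≡_; _≢_; refl; cong)

data Ty : Set where
  bool rat : Ty

⟦_⟧ : Ty → Set
⟦ bool ⟧ = Bool
⟦ rat ⟧ = ℚ

Valuation : (Var : Set) → (Var → Ty) → Set
Valuation Var ty = (x : Var) → ⟦ ty x ⟧

-- Programs.  L = Fin m.  τ ℓ ℓ' = nothing  means the formula ⊥;
-- τ ℓ ℓ' = just R means a formula over V ∪ V' whose meaning is R.

Holds : {S : Set} → Maybe (S → S → Set) → S → S → Set
Holds nothing s s' = ⊥
Holds (just R) s s' = R s s'

NotBot : {A : Set₁} → Maybe A → Set
NotBot nothing = ⊥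
NotBot (just _) = ⊤

record Program (m : ℕ) : Set₁ where
  field
    ℓo ℓe : Fin m
    Var : Set
    ty : Var → Ty
    τ : Fin m → Fin m → Maybe (Valuation Var ty → Valuation Var ty → Set)
    τ-into-init : ∀ ℓ → τ ℓ ℓo ≡ nothing
    τ-out-of-err : ∀ ℓ → τ ℓe ℓ ≡ nothing

  State : Set
  State = Valuation Var ty

  Step : Fin m → Fin m → State → State → Set
  Step ℓ ℓ' s s' = Holds (τ ℓ ℓ') s s'

open Program public

record IsCounterexample {m} (P : Program m) (k : ℕ)
         (path : Fin (suc k) → Fin m) (states : Fin (suc k) → State P) : Set where
  field
    start : path zero ≡ ℓo P
    end   : path (fromℕ k) ≡ ℓe P
    steps : ∀ (i : Fin k) →
            Step P (path (inject₁ i)) (path (suc i)) (states (inject₁ i)) (states (suc i))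

Safe : ∀ {m} → Program m → Set
Safe P = ∀ k path states → ¬ IsCounterexample P k path states

Conj : {S : Set} → List (S → Set) → S → Set
Conj [] s = ⊤
Conj (φ ∷ Φ) s = φ s × Conj Φ s

record IsSafetyProof {m} (P : Program m) (π : Fin m → List (State P → Set)) : Set where
  field
    err  : ∀ s → Conj (π (ℓe P)) s → ⊥
    init : ∀ s → Conj (π (ℓo P)) s
    ind  : ∀ ℓi ℓj s s' → Step P ℓi ℓj s s' → Conj (π ℓi) s → Conj (π ℓj) s'

-- Weak topological orders, as nested lists: a component is (h w) with
-- head vertex h followed by a WTO w (so no two consecutive open brackets).

data Elem (m : ℕ) : Set where
  vtx  : Fin m → Elem m
  comp : Fin m → List (Elem m) → Elem m

WTO : ℕ → Set
WTO m = List (Elem m)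

module _ {m : ℕ} where
  mutual
    flattenE : Elem m → List (Fin m)
    flattenE (vtx x) = [ x ]
    flattenE (comp h w) = h ∷ flatten w

    flatten : WTO m → List (Fin m)
    flatten [] = []
    flatten (e ∷ es) = flattenE e ++ flatten es

  mutual
    headsE : Elem m → List (Fin m)
    headsE (vtx x) = []
    headsE (comp h w) = h ∷ headsL w

    headsL : WTO m → List (Fin m)
    headsL [] = []
    headsL (e ∷ es) = headsE e ++ headsL es

  -- outside-in list of heads of the components containing ℓ
  mutual
    hdsE : Elem m → Fin m → Maybe (List (Fin m))
    hdsE (vtx x) ℓ with ⌊ x ≟ᶠ ℓ ⌋
    ... | true = just []
    ... | false = nothing
    hdsE (comp h w) ℓ with ⌊ h ≟ᶠ ℓ ⌋
    ... | true = just [ h ]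
    ... | false = mmap (h ∷_) (hdsL w ℓ)

    hdsL : WTO m → Fin m → Maybe (List (Fin m))
    hdsL [] ℓ = nothing
    hdsL (e ∷ es) ℓ = hdsE e ℓ <∣> hdsL es ℓ

  hds : WTO m → Fin m → List (Fin m)
  hds W ℓ = mfromMaybe [] (hdsL W ℓ)

  isHead : WTO m → Fin m → Bool
  isHead W h = any (λ x → ⌊ x ≟ᶠ h ⌋) (headsL W)

  Head : WTO m → Set
  Head W = Σ (Fin m) λ h → T (isHead W h)

  _≺[_]_ : Fin m → WTO m → Fin m → Set
  a ≺[ W ] b = ∃[ xs ] ∃[ ys ] ∃[ zs ] flatten W ≡ xs ++ a ∷ ys ++ b ∷ zs

  _≼[_]_ : Fin m → WTO m → Fin m → Set
  a ≼[ W ] b = a ≺[ W ] b ⊎ a ≡ b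

record IsWTO {m} (P : Program m) (W : WTO m) : Set where
  field
    covers   : ∀ ℓ → ℓ ∈ flatten W
    unique   : Unique (flatten W)
    backedge : ∀ ℓi ℓj → NotBot (τ P ℓi ℓj) → ℓj ≼[ W ] ℓi → ℓj ∈ hds W ℓi
    init-min : ∀ ℓ → ℓ ≢ ℓo P → ℓo P ≺[ W ] ℓ
    err-max  : ∀ ℓ → ℓ ≢ ℓe P → ℓ ≺[ W ] ℓe P

-- The bounded version  P̃ = ⟨ L, ℓo, ℓe, V ∪ C ∪ B, τ ∧ τ_B ⟩.
-- Variables: V ⊎ (C ⊎ B), with c_h = inj₂ (inj₁ h), b_h = inj₂ (inj₂ h).

module _ {m : ℕ} (P : Program m) (W : WTO m) where

  BVar : Set
  BVar = Var P ⊎ (Head W ⊎ Head W)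

  bty : BVar → Ty
  bty (inj₁ x) = ty P x
  bty (inj₂ _) = rat

  BState : Set
  BState = Valuation BVar bty

  cnt : BState → Head W → ℚ
  cnt s h = s (inj₂ (inj₁ h))

  bnd : BState → Head W → ℚ
  bnd s h = s (inj₂ (inj₂ h))

  restrict : BState → State P
  restrict s x = s (inj₁ x)

  extend : State P → (Head W → ℚ) → (Head W → ℚ) → BState
  extend s c b (inj₁ x) = s x
  extend s c b (inj₂ (inj₁ h)) = c h
  extend s c b (inj₂ (inj₂ h)) = b h

  τB : Fin m → Fin m → BState → BState → Set
  τB ℓi ℓj s s' =
    -- (Entry): no constraint
    -- (Re-entry)
    (ℓj ≼[ W ] ℓi → ∀ (h : Head W) → proj₁ h ≡ ℓj →
        (0ℚ ≤ cnt s' h) × (cnt s' h ≡ cnt s h - 1ℚ) × (cnt s h ≤ bnd s h))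
    × (ℓi ≺[ W ] ℓj → (∀ h → h ∈ hds W ℓj → h ∈ hds W ℓi) →
        ∀ (h : Head W) → proj₁ h ∈ hds W ℓi → proj₁ h ∉ hds W ℓj → cnt s h ≡ 0ℚ)
    × (∀ (h : Head W) → proj₁ h ∈ hds W ℓj → proj₁ h ≢ ℓj → cnt s' h ≡ cnt s h)

  τ̃ : Fin m → Fin m → Maybe (BState → BState → Set)
  τ̃ ℓi ℓj = mmap (λ R s s' → R (restrict s) (restrict s') × τB ℓi ℓj s s') (τ P ℓi ℓj)

  bounded : Program m
  bounded = record
    { ℓo = ℓo P ; ℓe = ℓe P ; Var = BVar ; ty = bty ; τ = τ̃
    ; τ-into-init = λ ℓ → cong (mmap _) (τ-into-init P ℓ)
    ; τ-out-of-err = λ ℓ → cong (mmap _) (τ-out-of-err P ℓ) }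

  NonNeg : (Head W → ℚ) → Set
  NonNeg c = ∀ h → 0ℚ ≤ c h

  forallBC : (BState → Set) → State P → Set
  forallBC φ s = ∀ (b c : Head W → ℚ) → NonNeg b → NonNeg c → φ (extend s c b)

-- Safety of the bounded version is no stronger than safety of P, because the counters and bounds
-- can always be chosen after the fact.  Walking a step ℓi → ℓj backwards from the counters c' of
-- the target state, take the counters of the source state to be c' + 1 on a re-entry into the head
-- ℓj, c' on every other head still enclosing ℓj, and 0 on every head that ℓj lies outside of; take
-- each bound equal to its counter.  These values are non-negative and satisfy τ_B, so every
-- counterexample of P lifts to one of the bounded version, and a safety proof of the bounded
-- version, instantiated at these values, yields one of P.  The argument only uses that the WTO
-- lists each location at most once.
module Submission where

open import Defs
open import Data.Nat using (ℕ; suc; zero)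
open import Data.Fin using (Fin; zero; suc; inject₁) renaming (_≟_ to _≟ᶠ_)
open import Data.Product using (_×_; _,_; proj₁; proj₂; ∃-syntax)
open import Data.Sum using (_⊎_; inj₁; inj₂)
open import Data.Unit using (tt)
open import Data.List using (List; []; _∷_; _++_; map)
open import Data.List.Properties using (∷-injectiveˡ; ∷-injectiveʳ)
open import Data.List.Membership.Propositional using (_∈_; _∉_)
open import Data.List.Membership.Propositional.Properties using (∈-∃++; ∈-++⁺ʳ)
import Data.List.Membership.DecPropositional as DecMembership
open import Data.List.Relation.Unary.Any using (here; there)
open import Data.List.Relation.Unary.All using () renaming (lookup to All-lookup)
open import Data.List.Relation.Unary.AllPairs using (_∷_)
open import Data.List.Relation.Unary.Unique.Propositional using (Unique)
open import Data.Maybe using (just)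
open import Data.Rational using (ℚ; 0ℚ; 1ℚ; _+_; _-_; -_; _≤_)
open import Data.Rational.Properties
  using (≤-refl; ≤ᵇ⇒≤; +-mono-≤; +-identityʳ; +-assoc; +-inverseʳ)
open import Function using (_∘_)
open import Relation.Binary.Definitions using (DecidableEquality)
open import Relation.Nullary using (¬_; Dec; yes; no)
open import Relation.Nullary.Decidable using (map′; _×-dec_; _⊎-dec_)
open import Relation.Binary.PropositionalEquality
  using (_≡_; _≢_; _≗_; refl; sym; cong; subst; module ≡-Reasoning)

module _ {A : Set} where

  Precedes : List A → A → A → Set
  Precedes l x y = ∃[ xs ] ∃[ ys ] ∃[ zs ] l ≡ xs ++ x ∷ ys ++ y ∷ zs

  Precedes-∈ʳ : ∀ {l x y} → Precedes l x y → y ∈ l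
  Precedes-∈ʳ (xs , ys , zs , refl) = ∈-++⁺ʳ xs (there (∈-++⁺ʳ ys (here refl)))

  Precedes-∷⁺ : ∀ {z l x y} → (z ≡ x × y ∈ l) ⊎ Precedes l x y → Precedes (z ∷ l) x y
  Precedes-∷⁺ (inj₁ (refl , y∈l)) with ys , zs , eq ← ∈-∃++ y∈l = [] , ys , zs , cong (_ ∷_) eq
  Precedes-∷⁺ (inj₂ (xs , ys , zs , eq)) = _ ∷ xs , ys , zs , cong (_ ∷_) eq

  Precedes-∷⁻ : ∀ {z l x y} → Precedes (z ∷ l) x y → (z ≡ x × y ∈ l) ⊎ Precedes l x y
  Precedes-∷⁻ ([] , ys , zs , eq) =
    inj₁ (∷-injectiveˡ eq , subst (_ ∈_) (sym (∷-injectiveʳ eq)) (∈-++⁺ʳ ys (here refl)))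
  Precedes-∷⁻ (_ ∷ xs , ys , zs , eq) = inj₂ (xs , ys , zs , ∷-injectiveʳ eq)

  Precedes-[] : ∀ {x y} → ¬ Precedes [] x y
  Precedes-[] ([] , _ , _ , ())
  Precedes-[] (_ ∷ _ , _ , _ , ())

  precedes? : DecidableEquality A → ∀ l x y → Dec (Precedes l x y)
  precedes? _≟_ [] x y = no Precedes-[]
  precedes? _≟_ (z ∷ l) x y =
    map′ Precedes-∷⁺ Precedes-∷⁻ ((z ≟ x ×-dec y ∈? l) ⊎-dec precedes? _≟_ l x y)
    where open DecMembership _≟_ using (_∈?_)

  Precedes-asym : ∀ {l x y} → Unique l → Precedes l x y → ¬ Precedes l y x
  Precedes-asym {[]}    _           p _ = Precedes-[] p
  Precedes-asym {z ∷ l} (z∉l ∷ u) p q with Precedes-∷⁻ p | Precedes-∷⁻ q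
  ... | inj₁ (refl , _)   | inj₁ (refl , z∈l) = All-lookup z∉l z∈l refl
  ... | inj₁ (refl , _)   | inj₂ q′           = All-lookup z∉l (Precedes-∈ʳ q′) refl
  ... | inj₂ p′           | inj₁ (refl , _)   = All-lookup z∉l (Precedes-∈ʳ p′) refl
  ... | inj₂ p′           | inj₂ q′           = Precedes-asym u p′ q′

0≤1 : 0ℚ ≤ 1ℚ
0≤1 = ≤ᵇ⇒≤ tt

0≤p⇒0≤p+1 : ∀ {p} → 0ℚ ≤ p → 0ℚ ≤ p + 1ℚ
0≤p⇒0≤p+1 {p} 0≤p = subst (_≤ p + 1ℚ) (+-identityʳ 0ℚ) (+-mono-≤ 0≤p 0≤1)

p+1-1≡p : ∀ p → p + 1ℚ - 1ℚ ≡ p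
p+1-1≡p p = begin
  p + 1ℚ - 1ℚ      ≡⟨ +-assoc p 1ℚ (- 1ℚ) ⟩
  p + (1ℚ - 1ℚ)    ≡⟨ cong (p +_) (+-inverseʳ 1ℚ) ⟩
  p + 0ℚ           ≡⟨ +-identityʳ p ⟩
  p                ∎
  where open ≡-Reasoning

module _ {m : ℕ} (P : Program m) (W : WTO m) where

  Step-restrict : ∀ {ℓi ℓj s s'} → Step (bounded P W) ℓi ℓj s s' →
                  Step P ℓi ℓj (restrict P W s) (restrict P W s')
  Step-restrict {ℓi} {ℓj} step with τ P ℓi ℓj
  ... | just R = proj₁ step

  Step-lift : ∀ {ℓi ℓj s s'} → Step P ℓi ℓj (restrict P W s) (restrict P W s') →
              τB P W ℓi ℓj s s' → Step (bounded P W) ℓi ℓj s s'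
  Step-lift {ℓi} {ℓj} step τB-holds with τ P ℓi ℓj
  ... | just R = step , τB-holds

  restrict-counterexample : ∀ {k path states} → IsCounterexample (bounded P W) k path states →
                            IsCounterexample P k path (restrict P W ∘ states)
  restrict-counterexample ce = record
    { start = start ; end = end ; steps = λ i → Step-restrict (steps i) }
    where open IsCounterexample ce

  Conj-forallBC⁻ : ∀ Φ {s} → Conj (map (forallBC P W) Φ) s → forallBC P W (Conj Φ) s
  Conj-forallBC⁻ []      _          b c _  _  = tt
  Conj-forallBC⁻ (φ ∷ Φ) (∀φ , ∀Φ) b c 0≤b 0≤c = ∀φ b c 0≤b 0≤c , Conj-forallBC⁻ Φ ∀Φ b c 0≤b 0≤c

  Conj-forallBC⁺ : ∀ Φ {s} → forallBC P W (Conj Φ) s → Conj (map (forallBC P W) Φ) s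
  Conj-forallBC⁺ []      _   = tt
  Conj-forallBC⁺ (φ ∷ Φ) ∀ΦΦ =
    (λ b c 0≤b 0≤c → proj₁ (∀ΦΦ b c 0≤b 0≤c)) ,
    Conj-forallBC⁺ Φ (λ b c 0≤b 0≤c → proj₂ (∀ΦΦ b c 0≤b 0≤c))

module Counters {m : ℕ} (P : Program m) (W : WTO m) (unique : Unique (flatten W)) where
  open DecMembership (_≟ᶠ_ {m}) using (_∈?_)

  ≺⇒⋠ : ∀ {ℓi ℓj} → ℓi ≺[ W ] ℓj → ¬ ℓj ≼[ W ] ℓi
  ≺⇒⋠ ℓi≺ℓj (inj₁ ℓj≺ℓi) = Precedes-asym unique ℓi≺ℓj ℓj≺ℓi
  ≺⇒⋠ ℓi≺ℓj (inj₂ refl)  = Precedes-asym unique ℓi≺ℓj ℓi≺ℓj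

  IsReentry : Fin m → Fin m → Head W → Set
  IsReentry ℓi ℓj h = ℓj ≼[ W ] ℓi × proj₁ h ≡ ℓj

  reentry? : ∀ ℓi ℓj h → Dec (IsReentry ℓi ℓj h)
  reentry? ℓi ℓj h = (precedes? _≟ᶠ_ (flatten W) ℓj ℓi ⊎-dec ℓj ≟ᶠ ℓi) ×-dec proj₁ h ≟ᶠ ℓj

  counterBefore : Fin m → Fin m → (Head W → ℚ) → Head W → ℚ
  counterBefore ℓi ℓj c' h with reentry? ℓi ℓj h | proj₁ h ∈? hds W ℓj
  ... | yes _ | _     = c' h + 1ℚ
  ... | no _  | yes _ = c' h
  ... | no _  | no _  = 0ℚ

  counterBefore-nonNeg : ∀ ℓi ℓj {c'} → NonNeg P W c' → NonNeg P W (counterBefore ℓi ℓj c')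
  counterBefore-nonNeg ℓi ℓj 0≤c' h with reentry? ℓi ℓj h | proj₁ h ∈? hds W ℓj
  ... | yes _ | _     = 0≤p⇒0≤p+1 (0≤c' h)
  ... | no _  | yes _ = 0≤c' h
  ... | no _  | no _  = ≤-refl

  counterBefore-reentry : ∀ {ℓi ℓj} c' h → IsReentry ℓi ℓj h →
                          counterBefore ℓi ℓj c' h ≡ c' h + 1ℚ
  counterBefore-reentry {ℓi} {ℓj} c' h r with reentry? ℓi ℓj h | proj₁ h ∈? hds W ℓj
  ... | yes _ | _ = refl
  ... | no ¬r | _ with () ← ¬r r

  counterBefore-inside : ∀ {ℓi ℓj} c' h → ¬ IsReentry ℓi ℓj h → proj₁ h ∈ hds W ℓj →
                         counterBefore ℓi ℓj c' h ≡ c' h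
  counterBefore-inside {ℓi} {ℓj} c' h ¬r h∈ with reentry? ℓi ℓj h | proj₁ h ∈? hds W ℓj
  ... | yes r | _      with () ← ¬r r
  ... | no _  | yes _  = refl
  ... | no _  | no h∉ with () ← h∉ h∈

  counterBefore-outside : ∀ {ℓi ℓj} c' h → ¬ IsReentry ℓi ℓj h → proj₁ h ∉ hds W ℓj →
                          counterBefore ℓi ℓj c' h ≡ 0ℚ
  counterBefore-outside {ℓi} {ℓj} c' h ¬r h∉ with reentry? ℓi ℓj h | proj₁ h ∈? hds W ℓj
  ... | yes r | _      with () ← ¬r r
  ... | no _  | yes h∈ with () ← h∉ h∈
  ... | no _  | no _   = refl

  τB-counterBefore : ∀ {ℓi ℓj} (s s' : State P) {c c' b'} → NonNeg P W c' →
                     c ≗ counterBefore ℓi ℓj c' →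
                     τB P W ℓi ℓj (extend P W s c c) (extend P W s' c' b')
  τB-counterBefore {ℓi} {ℓj} s s' {c} {c'} 0≤c' c≗ = reentry , exit , passOn
    where
    reentry : ℓj ≼[ W ] ℓi → ∀ h → proj₁ h ≡ ℓj → 0ℚ ≤ c' h × c' h ≡ c h - 1ℚ × c h ≤ c h
    reentry ℓj≼ℓi h h≡ℓj = 0≤c' h , c'≡c-1 , ≤-refl
      where
      open ≡-Reasoning
      c'≡c-1 : c' h ≡ c h - 1ℚ
      c'≡c-1 = sym (begin
        c h - 1ℚ          ≡⟨ cong (_- 1ℚ) (c≗ h) ⟩
        counterBefore ℓi ℓj c' h - 1ℚ
                          ≡⟨ cong (_- 1ℚ) (counterBefore-reentry c' h (ℓj≼ℓi , h≡ℓj)) ⟩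
        c' h + 1ℚ - 1ℚ    ≡⟨ p+1-1≡p (c' h) ⟩
        c' h              ∎)

    exit : ℓi ≺[ W ] ℓj → (∀ h → h ∈ hds W ℓj → h ∈ hds W ℓi) →
           ∀ h → proj₁ h ∈ hds W ℓi → proj₁ h ∉ hds W ℓj → c h ≡ 0ℚ
    exit ℓi≺ℓj _ h _ h∉ = begin
      c h                       ≡⟨ c≗ h ⟩
      counterBefore ℓi ℓj c' h  ≡⟨ counterBefore-outside c' h (≺⇒⋠ ℓi≺ℓj ∘ proj₁) h∉ ⟩
      0ℚ                        ∎
      where open ≡-Reasoning

    passOn : ∀ h → proj₁ h ∈ hds W ℓj → proj₁ h ≢ ℓj → c' h ≡ c h
    passOn h h∈ h≢ℓj = sym (begin
      c h                       ≡⟨ c≗ h ⟩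
      counterBefore ℓi ℓj c' h  ≡⟨ counterBefore-inside c' h (h≢ℓj ∘ proj₂) h∈ ⟩
      c' h                      ∎)
      where open ≡-Reasoning

  Step-lift-counterBefore : ∀ {ℓi ℓj s s' c c' b'} → Step P ℓi ℓj s s' → NonNeg P W c' →
                            c ≗ counterBefore ℓi ℓj c' →
                            Step (bounded P W) ℓi ℓj (extend P W s c c) (extend P W s' c' b')
  Step-lift-counterBefore {s = s} {s'} {b' = b'} step 0≤c' c≗ =
    Step-lift P W step (τB-counterBefore s s' {b' = b'} 0≤c' c≗)

  pathCounters : ∀ k → (Fin (suc k) → Fin m) → Fin (suc k) → Head W → ℚ
  pathCounters zero    path _       = λ _ → 0ℚ
  pathCounters (suc k) path zero    =
    counterBefore (path zero) (path (suc zero)) (pathCounters k (path ∘ suc) zero)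
  pathCounters (suc k) path (suc i) = pathCounters k (path ∘ suc) i

  pathCounters-nonNeg : ∀ k path i → NonNeg P W (pathCounters k path i)
  pathCounters-nonNeg zero    path _       _ = ≤-refl
  pathCounters-nonNeg (suc k) path zero      =
    counterBefore-nonNeg _ _ (pathCounters-nonNeg k (path ∘ suc) zero)
  pathCounters-nonNeg (suc k) path (suc i)   = pathCounters-nonNeg k (path ∘ suc) i

  pathCounters-step : ∀ k path (i : Fin k) →
    pathCounters k path (inject₁ i) ≗
      counterBefore (path (inject₁ i)) (path (suc i)) (pathCounters k path (suc i))
  pathCounters-step (suc k) path zero    _ = refl
  pathCounters-step (suc k) path (suc i)   = pathCounters-step k (path ∘ suc) i

  lift-counterexample :
    ∀ {k path states} → IsCounterexample P k path states →
    IsCounterexample (bounded P W) k path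
      (λ i → extend P W (states i) (pathCounters k path i) (pathCounters k path i))
  lift-counterexample {k} {path} ce = record
    { start = start
    ; end   = end
    ; steps = λ i → Step-lift-counterBefore (steps i)
                      (pathCounters-nonNeg k path (suc i)) (pathCounters-step k path i)
    }
    where open IsCounterexample ce

  restrict-safetyProof : ∀ {π̃} → IsSafetyProof (bounded P W) π̃ →
                         IsSafetyProof P (λ ℓ → map (forallBC P W) (π̃ ℓ))
  restrict-safetyProof {π̃} sp = record
    { err  = λ _ π-holds → err _ (Conj-forallBC⁻ P W (π̃ (ℓe P)) π-holds zeroCounters zeroCounters 0≤zeroCounters 0≤zeroCounters)
    ; init = λ _ → Conj-forallBC⁺ P W (π̃ (ℓo P)) λ _ _ _ _ → init _
    ; ind  = λ ℓi ℓj s s' step πi-holds → Conj-forallBC⁺ P W (π̃ ℓj) λ b' c' _ 0≤c' →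
        let c   = counterBefore ℓi ℓj c'
            0≤c = counterBefore-nonNeg ℓi ℓj 0≤c'
        in ind ℓi ℓj _ _ (Step-lift-counterBefore step 0≤c' λ _ → refl)
                         (Conj-forallBC⁻ P W (π̃ ℓi) πi-holds c c 0≤c 0≤c)
    }
    where
    open IsSafetyProof sp
    zeroCounters : Head W → ℚ
    zeroCounters _ = 0ℚ
    0≤zeroCounters : NonNeg P W zeroCounters
    0≤zeroCounters _ = ≤-refl

lemma2 : ∀ {m : ℕ} (P : Program m) (W : WTO m) → IsWTO P W →
    ((Safe P → Safe (bounded P W)) × (Safe (bounded P W) → Safe P))
    × (∀ k path states → IsCounterexample (bounded P W) k path states →
         IsCounterexample P k path (λ i → restrict P W (states i)))
    × (∀ (π̃ : _ → List (BState P W → Set)) → IsSafetyProof (bounded P W) π̃ →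
         IsSafetyProof P (λ ℓ → map (forallBC P W) (π̃ ℓ)))
lemma2 P W isW =
    ( (λ safe k path _ ce → safe k path _ (restrict-counterexample P W ce))
    , (λ safẽ k path _ ce → safẽ k path _ (lift-counterexample ce)) )
  , (λ _ _ _ → restrict-counterexample P W)
  , (λ _ → restrict-safetyProof)
  where open Counters P W (IsWTO.unique isW)
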